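{- Let $L$ be a nonnegative integer, and suppose the following statement holds: for all nonnegative integers $a,x,y,m,n,l$ with $a<L$, $y\neq 0$, $a = x+2^{mn}y$, $n$ a power of $2$, $y<2^n$, $2^{(m+1)n}\mid x$, the period length of $x+1$ in $B_\infty$ equal to $2^l$, and $l\le n$, we have that $\langle a\rangle$ is isomorphic to $\langle 2^{l+n}-2^n+y\rangle$ and, for every $i$, if $(2^{l+n}-2^n+y+1)\backslash i = 2^nw+y'$ with $y'<2^n$, then $(a+1)\backslash i = ((x+1)\backslash w)+2^{mn}y'$. Then for all nonnegative integers $s\le s'$ such that $2^{s'}-2^s<L$ and $s'-s$ is less than or equal to some power of $2$ which divides $2s$, the element $2^{s'}-2^s+1$ has period length $2^{s'-s}$.
   Context: For $n\ge0$, $B_n$ is the set $\{0,1,\dots,2^n-1\}$ with the binary operation $\backslash$ defined recursively by: $0\backslash x = x$; $x\backslash(2^n-1) = x-1$ for $x>0$; $x\backslash(y-1) = (x\backslash y)\backslash(x-1)$ for $x,y>0$. This is a well-defined left-distributive operation, and $B_n$ is a subalgebra of $B_N$ for $N\ge n$; $B_\infty$ is the union of all $B_n$ with operation $\backslash$ (on the nonnegative integers). For $x>0$ the sequence $x\backslash 0, x\backslash 1,\dots$ is periodic; its period length is the least positive $p$ with $x\backslash p = 0$, and it is a power of $2$. $\langle x\rangle$ denotes the subalgebra of $B_\infty$ generated by $x$. -}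

module Defs where

open import Data.Nat using (ℕ; zero; suc; _+_; _*_; _∸_; _^_; _≤_; _<_)
open import Data.Nat.Divisibility using (_∣_)
open import Data.Product using (Σ; _×_)
open import Relation.Binary.PropositionalEquality using (_≡_)
open import Relation.Nullary using (¬_)

-- Graph of the operation \ on B_n = {0,…,2^n-1}, following the recursive
-- definition literally:
--   0 \ y = y ;  x \ (2^n - 1) = x - 1  (x > 0) ;
--   x \ (y - 1) = (x \ y) \ (x - 1)     (x, y > 0).
-- BG n x y z  means  x \ y = z  in B_n.
data BG (n : ℕ) : ℕ → ℕ → ℕ → Set where
  bg-zero : ∀ {y} → y < 2 ^ n → BG n 0 y y
  bg-top  : ∀ {x'} → suc x' < 2 ^ n → BG n (suc x') (2 ^ n ∸ 1) x'
  bg-step : ∀ {x' y' u z} →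
            BG n (suc x') (suc y') u → BG n u x' z → BG n (suc x') y' z

-- The operation of B_∞ (union of the B_n): x \ y = z iff this holds in some B_n.
_⧵_≐_ : ℕ → ℕ → ℕ → Set
x ⧵ y ≐ z = Σ ℕ (λ n → BG n x y z)

PeriodLength : ℕ → ℕ → Set
PeriodLength x p = 0 < p × (x ⧵ p ≐ 0) × (∀ q → 0 < q → q < p → ¬ (x ⧵ q ≐ 0))

data Gen (a : ℕ) : ℕ → Set where
  gen-base : Gen a a
  gen-op   : ∀ {u v w} → Gen a u → Gen a v → u ⧵ v ≐ w → Gen a w

_≅⟨⟩_ : ℕ → ℕ → Set
a ≅⟨⟩ b = Σ (ℕ → ℕ) λ f →
    (∀ u → Gen a u → Gen b (f u))
  × (∀ u v → Gen a u → Gen a v → f u ≡ f v → u ≡ v)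
  × (∀ w → Gen b w → Σ ℕ λ u → Gen a u × f u ≡ w)
  × (∀ u v z → Gen a u → Gen a v → u ⧵ v ≐ z → f u ⧵ f v ≐ f z)

IsPow2 : ℕ → Set
IsPow2 n = Σ ℕ λ k → n ≡ 2 ^ k

Hyp : ℕ → Set
Hyp L = ∀ a x y m n l →
  a < L → ¬ (y ≡ 0) → a ≡ x + 2 ^ (m * n) * y → IsPow2 n → y < 2 ^ n →
  2 ^ ((m + 1) * n) ∣ x → PeriodLength (x + 1) (2 ^ l) → l ≤ n →
    (a ≅⟨⟩ (2 ^ (l + n) ∸ 2 ^ n + y))
  × (∀ i w y' → y' < 2 ^ n →
       (2 ^ (l + n) ∸ 2 ^ n + y + 1) ⧵ i ≐ (2 ^ n * w + y') →
       ∀ v → (x + 1) ⧵ w ≐ v → (a + 1) ⧵ i ≐ (v + 2 ^ (m * n) * y'))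

-- Put d = s' - s and n = 2^j with 2^j | s and d ≤ 2n, so that 2^s' - 2^s = 2^s (2^d - 1).
-- For n ≤ d and l = d - n, splitting 2^d - 1 = 2^n (2^l - 1) + (2^n - 1) writes
-- a = 2^s' - 2^s as x + 2^s y with x = 2^(s+n) (2^l - 1) of the same shape (gap l ≤ n) and
-- 2^(l+n) - 2^n + y + 1 = 2^d; for d ≤ n take x = 0 and y = 2^d - 1 instead. The hypothesis
-- then assembles the row of a + 1 from the row of x + 1 and the row i ↦ i mod 2^d of 2^d:
-- (a + 1) \ i = 2^s (i mod 2^d), which has period 2^d. Since l ≤ n, the recursion stops
-- after one step at the case d ≤ n, where x + 1 = 1.
--
-- The facts about B_∞ needed are classical: x \ 0 = 0 in B_n, proved by induction on n
-- through the projection B_(n+1) → B_n modulo 2^n; hence B_n ⊆ B_(n+1) and \ is a function on B_∞.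

{-# OPTIONS --safe #-}
module Submission where

open import Defs
open import Data.Nat using (ℕ; zero; suc; _+_; _*_; _∸_; _^_; _≤_; _<_; z≤n; s≤s; z<s; _<?_; _≤′_; ≤′-refl; ≤′-step)
open import Data.Nat.Properties
open import Data.Nat.DivMod
open import Data.Nat.Induction using (<-rec)
open import Data.Nat.Tactic.RingSolver using (solve-∀)
open import Data.Nat.Divisibility using (_∣_; divides; m∣m*n; _∣0; 1∣_; ∣-refl; ∣m∣n⇒∣m+n; *-cancelˡ-∣)
open import Data.Product using (Σ; ∃; _×_; _,_; proj₁; proj₂)
open import Data.Sum using (_⊎_; inj₁; inj₂)
open import Data.Empty using (⊥-elim)
open import Relation.Nullary using (¬_; yes; no)
open import Relation.Binary.PropositionalEquality
open import Function.Endo.Propositional ℕ using () renaming (_^_ to _^ᶠ_; ^-homo to ^ᶠ-homo)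

infixl 7 _mod2^_ _div2^_

_mod2^_ : ℕ → ℕ → ℕ
x mod2^ n = _%_ x (2 ^ n) {{m^n≢0 2 n}}

_div2^_ : ℕ → ℕ → ℕ
x div2^ n = _/_ x (2 ^ n) {{m^n≢0 2 n}}

2^n∸1+1≡2^n : ∀ n → 2 ^ n ∸ 1 + 1 ≡ 2 ^ n
2^n∸1+1≡2^n n = m∸n+n≡m (m^n>0 2 n)

suc[2^n∸1]≡2^n : ∀ n → suc (2 ^ n ∸ 1) ≡ 2 ^ n
suc[2^n∸1]≡2^n n = trans (+-comm 1 (2 ^ n ∸ 1)) (2^n∸1+1≡2^n n)

2^n∸1<2^n : ∀ n → 2 ^ n ∸ 1 < 2 ^ n
2^n∸1<2^n n = ≤-reflexive (suc[2^n∸1]≡2^n n)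

2^n∸1≢0 : ∀ n → 0 < n → 2 ^ n ∸ 1 ≢ 0
2^n∸1≢0 n 0<n = m>n⇒m∸n≢0 (^-monoʳ-< 2 (s≤s (s≤s z≤n)) {0} {n} 0<n)

2^s'∸2^s≡2^s*[2^[s'∸s]∸1] : ∀ {s s'} → s ≤ s' → 2 ^ s' ∸ 2 ^ s ≡ 2 ^ s * (2 ^ (s' ∸ s) ∸ 1)
2^s'∸2^s≡2^s*[2^[s'∸s]∸1] {s} {s'} s≤s' = begin
  2 ^ s' ∸ 2 ^ s                   ≡⟨ cong (λ k → 2 ^ k ∸ 2 ^ s) (m+[n∸m]≡n s≤s') ⟨
  2 ^ (s + (s' ∸ s)) ∸ 2 ^ s       ≡⟨ cong₂ _∸_ (sym (^-distribˡ-+-* 2 s (s' ∸ s))) (*-identityʳ (2 ^ s)) ⟨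
  2 ^ s * 2 ^ (s' ∸ s) ∸ 2 ^ s * 1 ≡⟨ *-distribˡ-∸ (2 ^ s) (2 ^ (s' ∸ s)) 1 ⟨
  2 ^ s * (2 ^ (s' ∸ s) ∸ 1)       ∎
  where open ≡-Reasoning

<2^n⇒≤2^n∸1 : ∀ n {y} → y < 2 ^ n → y ≤ 2 ^ n ∸ 1
<2^n⇒≤2^n∸1 n y<2^n = ≤-pred (subst (_ <_) (sym (suc[2^n∸1]≡2^n n)) y<2^n)

n<2^n : ∀ n → n < 2 ^ n
n<2^n zero    = z<s
n<2^n (suc n) = <-≤-trans (s≤s (n<2^n n)) (m<m+n (2 ^ n) (≤-trans (m^n>0 2 n) (m≤m+n (2 ^ n) 0)))

mersenne-split : ∀ a b → 2 ^ (a + b) ∸ 1 ≡ 2 ^ a * (2 ^ b ∸ 1) + (2 ^ a ∸ 1)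
mersenne-split a b = trans (cong (_∸ 1) (^-distribˡ-+-* 2 a b))
  (subst₂ (λ A B → A * B ∸ 1 ≡ A * (B ∸ 1) + (A ∸ 1)) (suc[2^n∸1]≡2^n a) (suc[2^n∸1]≡2^n b)
    (lemma (2 ^ a ∸ 1) (2 ^ b ∸ 1)))
  where
  lemma : ∀ A B → B + A * suc B ≡ suc A * B + A
  lemma = solve-∀

mod2^-< : ∀ x n → x mod2^ n < 2 ^ n
mod2^-< x n = m%n<n x (2 ^ n) {{m^n≢0 2 n}}

mod2^-id : ∀ {x} n → x < 2 ^ n → x mod2^ n ≡ x
mod2^-id n = m<n⇒m%n≡m {{m^n≢0 2 n}}

0-mod2^ : ∀ n → 0 mod2^ n ≡ 0
0-mod2^ n = m*n%n≡0 0 (2 ^ n) {{m^n≢0 2 n}}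

mod2^-split : ∀ N w → w < 2 ^ suc N → w ≡ w mod2^ N ⊎ w ≡ w mod2^ N + 2 ^ N
mod2^-split N w w<
  with w div2^ N | m<n*o⇒m/o<n {w} {2} {2 ^ N} {{m^n≢0 2 N}} w< | m≡m%n+[m/n]*n w (2 ^ N) {{m^n≢0 2 N}}
... | 0 | _ | w≡ = inj₁ (trans w≡ (+-identityʳ _))
... | 1 | _ | w≡ = inj₂ (trans w≡ (cong (w mod2^ N +_) (+-identityʳ (2 ^ N))))
... | suc (suc _) | s≤s (s≤s ()) | _

[2^N∸1]mod2^d : ∀ {d N} → d ≤ N → (2 ^ N ∸ 1) mod2^ d ≡ 2 ^ d ∸ 1
[2^N∸1]mod2^d {d} {N} d≤N = begin
  (2 ^ N ∸ 1) mod2^ d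
    ≡⟨ cong (λ k → (2 ^ k ∸ 1) mod2^ d) (sym (m+[n∸m]≡n d≤N)) ⟩
  (2 ^ (d + (N ∸ d)) ∸ 1) mod2^ d
    ≡⟨ cong (_mod2^ d) (mersenne-split d (N ∸ d)) ⟩
  (2 ^ d * (2 ^ (N ∸ d) ∸ 1) + (2 ^ d ∸ 1)) mod2^ d
    ≡⟨ %-remove-+ˡ (2 ^ d ∸ 1) {{m^n≢0 2 d}} (m∣m*n (2 ^ (N ∸ d) ∸ 1)) ⟩
  (2 ^ d ∸ 1) mod2^ d
    ≡⟨ mod2^-id d (2^n∸1<2^n d) ⟩
  2 ^ d ∸ 1 ∎
  where open ≡-Reasoning

mod2^-suc : ∀ n x → suc x mod2^ n ≡ suc (x mod2^ n) mod2^ n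
mod2^-suc n x = trans (cong (λ v → suc v mod2^ n) (m≡m%n+[m/n]*n x (2 ^ n) {{m^n≢0 2 n}}))
                    ([m+kn]%n≡m%n (suc (x mod2^ n)) (x div2^ n) (2 ^ n) {{m^n≢0 2 n}})

data SucMod2^ (n x : ℕ) : Set where
  wraps : suc x mod2^ n ≡ 0 → x mod2^ n ≡ 2 ^ n ∸ 1 → SucMod2^ n x
  steps : suc x mod2^ n ≡ suc (x mod2^ n) → suc (x mod2^ n) < 2 ^ n → SucMod2^ n x

sucMod2^ : ∀ n x → SucMod2^ n x
sucMod2^ n x with m≤n⇒m<n∨m≡n (mod2^-< x n)
... | inj₁ suc[x%]<2^n = steps (trans (mod2^-suc n x) (mod2^-id n suc[x%]<2^n)) suc[x%]<2^n
... | inj₂ suc[x%]≡2^n = wraps suc[x]%≡0 (%-pred-≡0 {{m^n≢0 2 n}} suc[x]%≡0)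
  where
  suc[x]%≡0 : suc x mod2^ n ≡ 0
  suc[x]%≡0 = trans (mod2^-suc n x) (trans (cong (_mod2^ n) suc[x%]≡2^n) (n%n≡0 (2 ^ n) {{m^n≢0 2 n}}))

descending-ind : ∀ {ℓ} (P : ℕ → Set ℓ) K → P K → (∀ y → y < K → P (suc y) → P y) →
                 ∀ y → y ≤ K → P y
descending-ind P K P[K] step y y≤K = go (K ∸ y) y (m+[n∸m]≡n y≤K)
  where
  go : ∀ t y → y + t ≡ K → P y
  go zero    y y+0≡K = subst P (trans (sym y+0≡K) (+-identityʳ y)) P[K]
  go (suc t) y eq    = step y (subst (y <_) eq (m<m+n y z<s)) (go t (suc y) (trans (sym (+-suc y t)) eq))

^ᶠ-comm : ∀ (F : ℕ → ℕ) a b z → (F ^ᶠ a) ((F ^ᶠ b) z) ≡ (F ^ᶠ b) ((F ^ᶠ a) z)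
^ᶠ-comm F a b z = begin
  (F ^ᶠ a) ((F ^ᶠ b) z) ≡⟨ cong-app (^ᶠ-homo F a b) z ⟨
  (F ^ᶠ (a + b)) z      ≡⟨ cong (λ k → (F ^ᶠ k) z) (+-comm a b) ⟩
  (F ^ᶠ (b + a)) z      ≡⟨ cong-app (^ᶠ-homo F b a) z ⟩
  (F ^ᶠ b) ((F ^ᶠ a) z) ∎
  where open ≡-Reasoning

iterate-return : ∀ (F : ℕ → ℕ) M {u v} → (∃ λ t → (F ^ᶠ t) u ≡ v) →
                 (F ^ᶠ M) u ≡ u ⊎ (F ^ᶠ M) u ≡ v → (F ^ᶠ M) v ≡ u ⊎ (F ^ᶠ M) v ≡ v →
                 (F ^ᶠ (2 * M)) v ≡ v
iterate-return F M {u} {v} (t , F^t[u]≡v) u↦ v↦ = trans (cong (λ k → (F ^ᶠ (M + k)) v) (+-identityʳ M))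
                                                (trans (cong-app (^ᶠ-homo F M M) v) (twice u↦ v↦))
  where
  fixed⇒twice : (F ^ᶠ M) v ≡ v → (F ^ᶠ M) ((F ^ᶠ M) v) ≡ v
  fixed⇒twice F^M[v]≡v = trans (cong (F ^ᶠ M) F^M[v]≡v) F^M[v]≡v
  twice : (F ^ᶠ M) u ≡ u ⊎ (F ^ᶠ M) u ≡ v → (F ^ᶠ M) v ≡ u ⊎ (F ^ᶠ M) v ≡ v →
          (F ^ᶠ M) ((F ^ᶠ M) v) ≡ v
  twice _              (inj₂ F^M[v]≡v) = fixed⇒twice F^M[v]≡v
  twice (inj₂ F^M[u]≡v) (inj₁ F^M[v]≡u) = trans (cong (F ^ᶠ M) F^M[v]≡u) F^M[u]≡v
  twice (inj₁ F^M[u]≡u) (inj₁ _)       = fixed⇒twice (begin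
    (F ^ᶠ M) v               ≡⟨ cong (F ^ᶠ M) F^t[u]≡v ⟨
    (F ^ᶠ M) ((F ^ᶠ t) u)    ≡⟨ ^ᶠ-comm F M t u ⟩
    (F ^ᶠ t) ((F ^ᶠ M) u)    ≡⟨ cong (F ^ᶠ t) F^M[u]≡u ⟩
    (F ^ᶠ t) u               ≡⟨ F^t[u]≡v ⟩
    v ∎)
    where open ≡-Reasoning

-- The tables B_n

BG-bounded : ∀ {n x y z} → BG n x y z → x < 2 ^ n × y < 2 ^ n × z < 2 ^ n
BG-bounded {n} (bg-zero y<) = m^n>0 2 n , y< , y<
BG-bounded {n} (bg-top x<)  = x< , 2^n∸1<2^n n , <-trans (n<1+n _) x<
BG-bounded (bg-step d e) with BG-bounded d | BG-bounded e
... | x< , suc[y]< , _ | _ , _ , z< = x< , <-trans (n<1+n _) suc[y]< , z<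

BG-zeroˡ-inv : ∀ {n y z} → BG n 0 y z → z ≡ y
BG-zeroˡ-inv (bg-zero _) = refl

BG-decreasing : ∀ {n x y z} → BG n (suc x) y z → z < suc x
BG-decreasing (bg-top _) = ≤-refl
BG-decreasing (bg-step {u = zero}  d e) rewrite BG-zeroˡ-inv e = ≤-refl
BG-decreasing (bg-step {u = suc _} d e) = <-trans (BG-decreasing e) (BG-decreasing d)

¬BG-column-2^n : ∀ {n x z} → ¬ BG n x (suc (2 ^ n ∸ 1)) z
¬BG-column-2^n {n} d = <-irrefl (suc[2^n∸1]≡2^n n) (proj₁ (proj₂ (BG-bounded d)))

BG-functional : ∀ {n x y z z'} → BG n x y z → BG n x y z' → z ≡ z'
BG-functional (bg-zero _)   (bg-zero _)     = refl
BG-functional (bg-top _)    (bg-top _)      = refl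
BG-functional (bg-top _)    (bg-step d _)   = ⊥-elim (¬BG-column-2^n d)
BG-functional (bg-step d _) (bg-top _)      = ⊥-elim (¬BG-column-2^n d)
BG-functional (bg-step d e) (bg-step d' e') with BG-functional d d'
... | refl = BG-functional e e'

BG-total : ∀ n x → x < 2 ^ n → ∀ y → y < 2 ^ n → ∃ (BG n x y)
BG-total n = <-rec _ total-row
  where
  total-row : ∀ x → (∀ {u} → u < x → u < 2 ^ n → ∀ y → y < 2 ^ n → ∃ (BG n u y)) →
              x < 2 ^ n → ∀ y → y < 2 ^ n → ∃ (BG n x y)
  total-row zero     _   _  y y< = y , bg-zero y<
  total-row (suc x') rec x< y y< =
    descending-ind (λ y → ∃ (BG n (suc x') y)) (2 ^ n ∸ 1) (x' , bg-top x<) step y (<2^n⇒≤2^n∸1 n y<)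
    where
    step : ∀ y → y < 2 ^ n ∸ 1 → ∃ (BG n (suc x') (suc y)) → ∃ (BG n (suc x') y)
    step y _ (u , d) with rec (BG-decreasing d) (<-trans (BG-decreasing d) x<) x' (<-trans (n<1+n x') x<)
    ... | z , e = z , bg-step d e

infix 8 _⧵⟨_⟩_

_⧵⟨_⟩_ : ℕ → ℕ → ℕ → ℕ
x ⧵⟨ n ⟩ y with x <? 2 ^ n | y <? 2 ^ n
... | yes x< | yes y< = proj₁ (BG-total n x x< y y<)
... | _      | _      = 0

⧵⟨⟩-BG : ∀ {n x y} → x < 2 ^ n → y < 2 ^ n → BG n x y (x ⧵⟨ n ⟩ y)
⧵⟨⟩-BG {n} {x} {y} x< y< with x <? 2 ^ n | y <? 2 ^ n
... | yes x<' | yes y<' = proj₂ (BG-total n x x<' y y<')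
... | no x≮   | _       = ⊥-elim (x≮ x<)
... | yes _   | no y≮   = ⊥-elim (y≮ y<)

BG⇒⧵⟨⟩ : ∀ {n x y z} → BG n x y z → x ⧵⟨ n ⟩ y ≡ z
BG⇒⧵⟨⟩ d with BG-bounded d
... | x< , y< , _ = BG-functional (⧵⟨⟩-BG x< y<) d

row-by-descent : ∀ {n x'} (f : ℕ → ℕ) → suc x' < 2 ^ n → f (2 ^ n ∸ 1) ≡ x' →
                 (∀ y → y < 2 ^ n ∸ 1 → BG n (f (suc y)) x' (f y)) →
                 ∀ y → y < 2 ^ n → BG n (suc x') y (f y)
row-by-descent {n} {x'} f x< f[top]≡x' step y y< =
  descending-ind (λ y → BG n (suc x') y (f y)) (2 ^ n ∸ 1)
    (subst (BG n (suc x') (2 ^ n ∸ 1)) (sym f[top]≡x') (bg-top x<))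
    (λ y y<top d → bg-step d (step y y<top)) y (<2^n⇒≤2^n∸1 n y<)

-- Column 0 of B_n

-- 0 plays the role of 2^n in the classical Laver table A_n: this is p ⋆ 2^n = 2^n.
RightZero : ℕ → Set
RightZero n = ∀ x → x < 2 ^ n → BG n x 0 0

BG-top-mod : ∀ N x' → BG N (suc x' mod2^ N) ((2 ^ suc N ∸ 1) mod2^ N) (x' mod2^ N)
BG-top-mod N x' rewrite [2^N∸1]mod2^d (n≤1+n N) with sucMod2^ N x'
... | wraps x-wraps x'top rewrite x-wraps | x'top = bg-zero (2^n∸1<2^n N)
... | steps x-steps suc[x']< rewrite x-steps = bg-top suc[x']<

BG-step-mod : ∀ {N} → RightZero N → ∀ x' y' {u z} →
              BG N (suc x' mod2^ N) (suc y' mod2^ N) u → BG N u (x' mod2^ N) z →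
              BG N (suc x' mod2^ N) (y' mod2^ N) z
BG-step-mod {N} rz x' y' d e with sucMod2^ N x' | sucMod2^ N y'
... | wraps x-wraps x'top | wraps y-wraps y'top rewrite x-wraps | x'top | y-wraps | y'top =
  subst (λ v → BG N v (2 ^ N ∸ 1) _) (BG-zeroˡ-inv d) e
... | wraps x-wraps x'top | steps y-steps suc[y']< rewrite x-wraps | x'top | y-steps | BG-zeroˡ-inv d =
  subst (BG N 0 _) (BG-functional (bg-top suc[y']<) e) (bg-zero (<-trans (n<1+n _) suc[y']<))
... | steps x-steps suc[x']< | wraps y-wraps y'top rewrite x-steps | y-wraps | y'top
  | BG-functional d (rz (suc (x' mod2^ N)) suc[x']<) | BG-zeroˡ-inv e = bg-top suc[x']<
... | steps x-steps _ | steps y-steps _ rewrite x-steps | y-steps = bg-step d e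

BG-mod : ∀ {N x y z} → RightZero N → BG (suc N) x y z → BG N (x mod2^ N) (y mod2^ N) (z mod2^ N)
BG-mod {N} rz (bg-zero {y} _)     rewrite 0-mod2^ N = bg-zero (mod2^-< y N)
BG-mod {N} rz (bg-top {x'} _)     = BG-top-mod N x'
BG-mod rz (bg-step {x'} {y'} d e) = BG-step-mod rz x' y' (BG-mod rz d) (BG-mod rz e)

-- Unfolding x \ (y - 1) = (x \ y) \ (x - 1) downwards from y = 2^n - 1, the row of x' + 1
-- is the orbit of x' under F = (_\ x').
module Orbit {n x'} (x< : suc x' < 2 ^ n) where

  F : ℕ → ℕ
  F z = z ⧵⟨ n ⟩ x'

  F-BG : ∀ {z} → z ≤ x' → BG n z x' (F z)
  F-BG z≤x' = ⧵⟨⟩-BG (≤-<-trans z≤x' x'<2^n) x'<2^n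
    where
    x'<2^n : x' < 2 ^ n
    x'<2^n = <-trans (n<1+n x') x<

  F-zero : F 0 ≡ x'
  F-zero = BG-zeroˡ-inv (F-BG z≤n)

  F-decreasing : ∀ {z} → suc z ≤ x' → F (suc z) < suc z
  F-decreasing z≤x' = BG-decreasing (F-BG z≤x')

  F-≤ : ∀ {z} → z ≤ x' → F z ≤ x'
  F-≤ {zero}  _     = ≤-reflexive F-zero
  F-≤ {suc z} z≤x' = <⇒≤ (<-≤-trans (F-decreasing z≤x') z≤x')

  F^-≤ : ∀ t {z} → z ≤ x' → (F ^ᶠ t) z ≤ x'
  F^-≤ zero    z≤x' = z≤x'
  F^-≤ (suc t) z≤x' = F-≤ (F^-≤ t z≤x')

  F≡x'⇒≡0 : ∀ {z} → z ≤ x' → F z ≡ x' → z ≡ 0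
  F≡x'⇒≡0 {zero}  _    _       = refl
  F≡x'⇒≡0 {suc z} z≤x' F[z]≡x' = ⊥-elim (<-irrefl F[z]≡x' (<-≤-trans (F-decreasing z≤x') z≤x'))

  reaches-x' : ∀ z → z ≤ x' → ∃ λ t → (F ^ᶠ t) z ≡ x'
  reaches-x' = <-rec _ reach
    where
    reach : ∀ z → (∀ {w} → w < z → w ≤ x' → ∃ λ t → (F ^ᶠ t) w ≡ x') →
            z ≤ x' → ∃ λ t → (F ^ᶠ t) z ≡ x'
    reach zero    _   _    = 1 , F-zero
    reach (suc z) rec z≤x' with rec (F-decreasing z≤x') (F-≤ z≤x')
    ... | t , F^t[Fz]≡x' = t + 1 , trans (cong-app (^ᶠ-homo F t 1) (suc z)) F^t[Fz]≡x'

  column-zero : BG n (suc x') 0 ((F ^ᶠ (2 ^ n ∸ 1)) x')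
  column-zero = row-by-descent (λ y → (F ^ᶠ (2 ^ n ∸ 1 ∸ y)) x') x<
                  (cong (λ k → (F ^ᶠ k) x') (n∸n≡0 (2 ^ n ∸ 1))) step 0 (m^n>0 2 n)
    where
    step : ∀ y → y < 2 ^ n ∸ 1 → BG n ((F ^ᶠ (2 ^ n ∸ 1 ∸ suc y)) x') x' ((F ^ᶠ (2 ^ n ∸ 1 ∸ y)) x')
    step y y<top = subst (λ k → BG n ((F ^ᶠ (2 ^ n ∸ 1 ∸ suc y)) x') x' ((F ^ᶠ k) x'))
                     (sym (+-∸-assoc 1 y<top)) (F-BG (F^-≤ (2 ^ n ∸ 1 ∸ suc y) ≤-refl))

BG-mod-below : ∀ {N x' y z} → RightZero N → suc x' ≤ 2 ^ N → BG (suc N) (suc x') y z →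
               BG N (suc x' mod2^ N) (y mod2^ N) z
BG-mod-below {N} rz x≤2^N d = subst (BG N _ _) (mod2^-id N (<-≤-trans (BG-decreasing d) x≤2^N)) (BG-mod rz d)

rightZero-suc-low : ∀ {N x'} → RightZero N → suc x' ≤ 2 ^ N → suc x' < 2 ^ suc N → BG (suc N) (suc x') 0 0
rightZero-suc-low {N} {x'} rz x≤2^N x< = subst (BG (suc N) (suc x') 0) x⧵0≡0 x⧵0
  where
  x⧵0 : BG (suc N) (suc x') 0 (suc x' ⧵⟨ suc N ⟩ 0)
  x⧵0 = ⧵⟨⟩-BG x< (m^n>0 2 (suc N))
  x⧵0≡0 : suc x' ⧵⟨ suc N ⟩ 0 ≡ 0
  x⧵0≡0 = BG-functional (subst (λ v → BG N (suc x' mod2^ N) v (suc x' ⧵⟨ suc N ⟩ 0)) (0-mod2^ N)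
                           (BG-mod-below rz x≤2^N x⧵0))
                        (rz _ (mod2^-< (suc x') N))

-- Reduction mod 2^N turns F into G, and G^(2^N) fixes x₀ by the column 0 of x₀ + 1 in B_N.
-- So F^(2^N) maps the fibre {x₀, x'} over x₀ into itself, and iterate-return closes the
-- orbit of x' after 2^(N+1) steps, which puts 0 in column 0 of the row of x' + 1.
rightZero-suc-high : ∀ {N x'} → RightZero N → 2 ^ N ≤ x' → suc x' < 2 ^ suc N → BG (suc N) (suc x') 0 0
rightZero-suc-high {N} {x'} rz 2^N≤x' x< = subst (BG (suc N) (suc x') 0) F^top[x']≡0 column-zero
  where
  open Orbit {suc N} x<

  x₀ : ℕ
  x₀ = x' mod2^ N

  x'≡x₀+2^N : x' ≡ x₀ + 2 ^ N
  x'≡x₀+2^N with mod2^-split N x' (<-trans (n<1+n x') x<)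
  ... | inj₁ x'≡x₀ = ⊥-elim (<-irrefl (sym x'≡x₀) (<-≤-trans (mod2^-< x' N) 2^N≤x'))
  ... | inj₂ x'≡x₀+2^N = x'≡x₀+2^N

  x₀≤x' : x₀ ≤ x'
  x₀≤x' = subst (x₀ ≤_) (sym x'≡x₀+2^N) (m≤m+n x₀ (2 ^ N))

  suc[x₀]< : suc x₀ < 2 ^ N
  suc[x₀]< = +-cancelʳ-< (2 ^ N) (suc x₀) (2 ^ N)
               (subst₂ _<_ (cong suc x'≡x₀+2^N) (cong (2 ^ N +_) (+-identityʳ (2 ^ N))) x<)

  module G = Orbit {N} suc[x₀]<

  F-over-G : ∀ t {z} → z ≤ x' → (F ^ᶠ t) z mod2^ N ≡ (G.F ^ᶠ t) (z mod2^ N)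
  F-over-G zero    _    = refl
  F-over-G (suc t) z≤x' = trans (sym (BG⇒⧵⟨⟩ (BG-mod rz (F-BG (F^-≤ t z≤x'))))) (cong G.F (F-over-G t z≤x'))

  G^2^N[x₀]≡x₀ : (G.F ^ᶠ 2 ^ N) x₀ ≡ x₀
  G^2^N[x₀]≡x₀ = subst (λ k → (G.F ^ᶠ k) x₀ ≡ x₀) (suc[2^n∸1]≡2^n N)
                   (trans (cong G.F (BG-functional G.column-zero (rz (suc x₀) suc[x₀]<))) G.F-zero)

  fibre : ∀ {w} → w ≤ x' → w mod2^ N ≡ x₀ → w ≡ x₀ ⊎ w ≡ x'
  fibre {w} w≤x' w%≡x₀ with mod2^-split N w (≤-<-trans w≤x' (<-trans (n<1+n x') x<))
  ... | inj₁ w≡w%     = inj₁ (trans w≡w% w%≡x₀)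
  ... | inj₂ w≡w%+2^N = inj₂ (trans w≡w%+2^N (trans (cong (_+ 2 ^ N) w%≡x₀) (sym x'≡x₀+2^N)))

  F^2^N-in-fibre : ∀ {z} → z ≤ x' → z mod2^ N ≡ x₀ → (F ^ᶠ 2 ^ N) z ≡ x₀ ⊎ (F ^ᶠ 2 ^ N) z ≡ x'
  F^2^N-in-fibre z≤x' z%≡x₀ = fibre (F^-≤ (2 ^ N) z≤x')
    (trans (F-over-G (2 ^ N) z≤x') (trans (cong (G.F ^ᶠ 2 ^ N) z%≡x₀) G^2^N[x₀]≡x₀))

  F^top[x']≡0 : (F ^ᶠ (2 ^ suc N ∸ 1)) x' ≡ 0
  F^top[x']≡0 = F≡x'⇒≡0 (F^-≤ (2 ^ suc N ∸ 1) ≤-refl)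
    (trans (cong (λ k → (F ^ᶠ k) x') (suc[2^n∸1]≡2^n (suc N)))
           (iterate-return F (2 ^ N) (reaches-x' x₀ x₀≤x')
              (F^2^N-in-fibre x₀≤x' (mod2^-id N (mod2^-< x' N))) (F^2^N-in-fibre ≤-refl refl)))

rightZero-suc : ∀ N → RightZero N → RightZero (suc N)
rightZero-suc N rz zero     _  = bg-zero (m^n>0 2 (suc N))
rightZero-suc N rz (suc x') x< with x' <? 2 ^ N
... | yes x'<2^N = rightZero-suc-low rz x'<2^N x<
... | no  x'≮2^N = rightZero-suc-high rz (≮⇒≥ x'≮2^N) x<

rightZero : ∀ n → RightZero n
rightZero zero    zero    _       = bg-zero z<s
rightZero zero    (suc x) (s≤s ())
rightZero (suc N) = rightZero-suc N (rightZero N)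

-- B_∞

BG-lift-suc : ∀ {N x y z} → BG N x y z → BG (suc N) x y z
BG-lift-suc {N} (bg-zero y<) = bg-zero (<-≤-trans y< (^-monoʳ-≤ 2 (n≤1+n N)))
BG-lift-suc {N} {suc x'} {y} {z} d = subst (BG (suc N) (suc x') y) x⧵y≡z x⧵y
  where
  x<2^N : suc x' < 2 ^ N
  x<2^N = proj₁ (BG-bounded d)
  y<2^N : y < 2 ^ N
  y<2^N = proj₁ (proj₂ (BG-bounded d))
  x⧵y : BG (suc N) (suc x') y (suc x' ⧵⟨ suc N ⟩ y)
  x⧵y = ⧵⟨⟩-BG (<-≤-trans x<2^N (^-monoʳ-≤ 2 (n≤1+n N))) (<-≤-trans y<2^N (^-monoʳ-≤ 2 (n≤1+n N)))
  x⧵y≡z : suc x' ⧵⟨ suc N ⟩ y ≡ z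
  x⧵y≡z = BG-functional (subst₂ (λ u v → BG N u v (suc x' ⧵⟨ suc N ⟩ y)) (mod2^-id N x<2^N) (mod2^-id N y<2^N)
                            (BG-mod-below (rightZero N) (<⇒≤ x<2^N) x⧵y)) d

BG-lift : ∀ {n N x y z} → n ≤ N → BG n x y z → BG N x y z
BG-lift n≤N d = lift (≤⇒≤′ n≤N)
  where
  lift : ∀ {N} → _ ≤′ N → BG N _ _ _
  lift ≤′-refl        = d
  lift (≤′-step n≤′N) = BG-lift-suc (lift n≤′N)

⧵-functional : ∀ {x y z z'} → x ⧵ y ≐ z → x ⧵ y ≐ z' → z ≡ z'
⧵-functional (n , d) (n' , d') = BG-functional (BG-lift (m≤m+n n n') d) (BG-lift (m≤n+m n' n) d')

row-one : ∀ i → 1 ⧵ i ≐ 0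
row-one i = suc i , row-by-descent {suc i} (λ _ → 0) (^-monoʳ-< 2 (s≤s (s≤s z≤n)) {0} {suc i} z<s) refl
                                (λ _ _ → bg-zero (m^n>0 2 (suc i))) i (<-≤-trans (n<2^n i) (^-monoʳ-≤ 2 (n≤1+n i)))

row-pow : ∀ d i → (2 ^ d) ⧵ i ≐ (i mod2^ d)
row-pow d i = N , subst (λ x → BG N x i (i mod2^ d)) (suc[2^n∸1]≡2^n d)
                    (row-by-descent (_mod2^ d) 2^d<2^N ([2^N∸1]mod2^d (<⇒≤ d<N)) step i i<2^N)
  where
  N : ℕ
  N = suc (d + i)
  d<N : d < N
  d<N = s≤s (m≤m+n d i)
  i<2^N : i < 2 ^ N
  i<2^N = <-≤-trans (n<2^n i) (^-monoʳ-≤ 2 (<⇒≤ (s≤s (m≤n+m i d))))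
  2^d<2^N : suc (2 ^ d ∸ 1) < 2 ^ N
  2^d<2^N = subst (_< 2 ^ N) (sym (suc[2^n∸1]≡2^n d)) (^-monoʳ-< 2 (s≤s (s≤s z≤n)) d<N)
  step : ∀ y → y < 2 ^ N ∸ 1 → BG N (suc y mod2^ d) (2 ^ d ∸ 1) (y mod2^ d)
  step y _ with sucMod2^ d y
  ... | wraps y-wraps y'top rewrite y-wraps | y'top = bg-zero (<-trans (n<1+n _) 2^d<2^N)
  ... | steps y-steps suc[y%]< rewrite y-steps = BG-lift (<⇒≤ d<N) (bg-top suc[y%]<)

-- Rows of 2^s' - 2^s + 1

ScaledModRow : ℕ → ℕ → ℕ → Set
ScaledModRow e t d = ∀ i → e ⧵ i ≐ (2 ^ t * (i mod2^ d))

scaledModRow-one : ∀ t → ScaledModRow 1 t 0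
scaledModRow-one t i = subst (1 ⧵ i ≐_) (sym (trans (cong (2 ^ t *_) (n%1≡0 i)) (*-zeroʳ (2 ^ t)))) (row-one i)

scaledModRow⇒periodLength : ∀ {e} t d → ScaledModRow e t d → PeriodLength e (2 ^ d)
scaledModRow⇒periodLength {e} t d row = m^n>0 2 d , subst (e ⧵ (2 ^ d) ≐_) 2^t*0≡0 (row (2 ^ d)) , no-earlier-zero
  where
  2^t*0≡0 : 2 ^ t * (2 ^ d mod2^ d) ≡ 0
  2^t*0≡0 = trans (cong (2 ^ t *_) (n%n≡0 (2 ^ d) {{m^n≢0 2 d}})) (*-zeroʳ (2 ^ t))
  no-earlier-zero : ∀ q → 0 < q → q < 2 ^ d → ¬ (e ⧵ q ≐ 0)
  no-earlier-zero q 0<q q<2^d e⧵q≐0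
    with m*n≡0⇒m≡0∨n≡0 (2 ^ t) (trans (cong (2 ^ t *_) (sym (mod2^-id d q<2^d))) (⧵-functional (row q) e⧵q≐0))
  ... | inj₁ 2^t≡0 = <-irrefl (sym 2^t≡0) (m^n>0 2 t)
  ... | inj₂ q≡0   = <-irrefl (sym q≡0) 0<q

scaledModRow-transfer : ∀ {L} → Hyp L → ∀ {s n x y l d} → IsPow2 n → n ∣ s →
               x + 2 ^ s * y < L → y ≢ 0 → y < 2 ^ n → 2 ^ (s + n) ∣ x → l ≤ n → d ≤ l + n →
               2 ^ (l + n) ∸ 2 ^ n + y + 1 ≡ 2 ^ d →
               ScaledModRow (x + 1) (s + n) l → ScaledModRow (x + 2 ^ s * y + 1) s d
scaledModRow-transfer hyp {n = n} {x} {y} {l} {d} n-pow (divides m refl) a<L y≢0 y<2^n 2^[s+n]∣x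
                      l≤n d≤l+n c≡2^d row[x+1] i =
  subst (λ v → (x + 2 ^ (m * n) * y + 1) ⧵ i ≐ v) recombine
    (row-rule i w y' (mod2^-< r n) c⧵i (2 ^ (m * n + n) * (w mod2^ l)) (row[x+1] w))
  where
  [m+1]*n≡m*n+n : (m + 1) * n ≡ m * n + n
  [m+1]*n≡m*n+n = trans (*-distribʳ-+ n m 1) (cong (m * n +_) (*-identityˡ n))
  row-rule : ∀ i w y' → y' < 2 ^ n → (2 ^ (l + n) ∸ 2 ^ n + y + 1) ⧵ i ≐ (2 ^ n * w + y') →
             ∀ v → (x + 1) ⧵ w ≐ v → (x + 2 ^ (m * n) * y + 1) ⧵ i ≐ (v + 2 ^ (m * n) * y')
  row-rule = proj₂ (hyp (x + 2 ^ (m * n) * y) x y m n l a<L y≢0 refl n-pow y<2^n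
               (subst (λ k → 2 ^ k ∣ x) (sym [m+1]*n≡m*n+n) 2^[s+n]∣x)
               (scaledModRow⇒periodLength (m * n + n) l row[x+1]) l≤n)
  r w y' : ℕ
  r = i mod2^ d
  w = r div2^ n
  y' = r mod2^ n
  r≡2^n*w+y' : r ≡ 2 ^ n * w + y'
  r≡2^n*w+y' = trans (m≡m%n+[m/n]*n r (2 ^ n) {{m^n≢0 2 n}})
                     (trans (+-comm y' (w * 2 ^ n)) (cong (_+ y') (*-comm w (2 ^ n))))
  c⧵i : (2 ^ (l + n) ∸ 2 ^ n + y + 1) ⧵ i ≐ (2 ^ n * w + y')
  c⧵i = subst₂ (λ e v → e ⧵ i ≐ v) (sym c≡2^d) r≡2^n*w+y' (row-pow d i)
  w<2^l : w < 2 ^ l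
  w<2^l = m<n*o⇒m/o<n {{m^n≢0 2 n}}
            (<-≤-trans (mod2^-< i d) (subst (2 ^ d ≤_) (^-distribˡ-+-* 2 l n) (^-monoʳ-≤ 2 d≤l+n)))
  recombine : 2 ^ (m * n + n) * (w mod2^ l) + 2 ^ (m * n) * y' ≡ 2 ^ (m * n) * r
  recombine = begin
    2 ^ (m * n + n) * (w mod2^ l) + 2 ^ (m * n) * y'
      ≡⟨ cong (λ v → 2 ^ (m * n + n) * v + 2 ^ (m * n) * y') (mod2^-id l w<2^l) ⟩
    2 ^ (m * n + n) * w + 2 ^ (m * n) * y'
      ≡⟨ cong (λ v → v * w + 2 ^ (m * n) * y') (^-distribˡ-+-* 2 (m * n) n) ⟩
    2 ^ (m * n) * 2 ^ n * w + 2 ^ (m * n) * y'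
      ≡⟨ distrib (2 ^ (m * n)) (2 ^ n) w y' ⟩
    2 ^ (m * n) * (2 ^ n * w + y')
      ≡⟨ cong (2 ^ (m * n) *_) r≡2^n*w+y' ⟨
    2 ^ (m * n) * r
      ∎
    where
    open ≡-Reasoning
    distrib : ∀ a b c e → a * b * c + a * e ≡ a * (b * c + e)
    distrib = solve-∀

scaledModRow-short : ∀ {L} → Hyp L → ∀ j {s d} → 2 ^ j ∣ s → d ≤ 2 ^ j → 2 ^ s * (2 ^ d ∸ 1) < L →
                     ScaledModRow (2 ^ s * (2 ^ d ∸ 1) + 1) s d
scaledModRow-short hyp j {s} {zero} _ _ _ =
  subst (λ e → ScaledModRow (e + 1) s 0) (sym (*-zeroʳ (2 ^ s))) (scaledModRow-one s)
scaledModRow-short hyp j {s} {d@(suc _)} 2^j∣s d≤2^j a<L =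
  scaledModRow-transfer hyp (j , refl) 2^j∣s a<L (2^n∸1≢0 d z<s) (<-≤-trans (2^n∸1<2^n d) (^-monoʳ-≤ 2 d≤2^j))
    (_ ∣0) z≤n d≤2^j c≡2^d (scaledModRow-one (s + 2 ^ j))
  where
  c≡2^d : 2 ^ (2 ^ j) ∸ 2 ^ (2 ^ j) + (2 ^ d ∸ 1) + 1 ≡ 2 ^ d
  c≡2^d = trans (cong (λ v → v + (2 ^ d ∸ 1) + 1) (n∸n≡0 (2 ^ (2 ^ j)))) (2^n∸1+1≡2^n d)

scaledModRow-long : ∀ {L} → Hyp L → ∀ j {s d} → 2 ^ j ∣ s → 2 ^ j ≤ d → d ≤ 2 * 2 ^ j →
                    2 ^ s * (2 ^ d ∸ 1) < L →
                    ScaledModRow (2 ^ s * (2 ^ d ∸ 1) + 1) s d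
scaledModRow-long {L} hyp j {s} {d} 2^j∣s n≤d d≤2n a<L =
  subst (λ e → ScaledModRow (e + 1) s d) (sym a≡x+2^s*y)
    (scaledModRow-transfer hyp (j , refl) 2^j∣s (subst (_< L) a≡x+2^s*y a<L) (2^n∸1≢0 n (m^n>0 2 j)) (2^n∸1<2^n n)
       (m∣m*n (2 ^ l ∸ 1)) l≤n (≤-reflexive (sym l+n≡d)) c≡2^d
       (scaledModRow-short hyp j (∣m∣n⇒∣m+n 2^j∣s ∣-refl) l≤n x<L))
  where
  n l x : ℕ
  n = 2 ^ j
  l = d ∸ n
  x = 2 ^ (s + n) * (2 ^ l ∸ 1)
  l+n≡d : l + n ≡ d
  l+n≡d = m∸n+n≡m n≤d
  l≤n : l ≤ n
  l≤n = ≤-trans (m≤n+o⇒m∸n≤o d n d≤2n) (≤-reflexive (+-identityʳ n))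
  a≡x+2^s*y : 2 ^ s * (2 ^ d ∸ 1) ≡ x + 2 ^ s * (2 ^ n ∸ 1)
  a≡x+2^s*y = begin
    2 ^ s * (2 ^ d ∸ 1)
      ≡⟨ cong (λ k → 2 ^ s * (2 ^ k ∸ 1)) (m+[n∸m]≡n n≤d) ⟨
    2 ^ s * (2 ^ (n + l) ∸ 1)
      ≡⟨ cong (2 ^ s *_) (mersenne-split n l) ⟩
    2 ^ s * (2 ^ n * (2 ^ l ∸ 1) + (2 ^ n ∸ 1))
      ≡⟨ distrib (2 ^ s) (2 ^ n) (2 ^ l ∸ 1) (2 ^ n ∸ 1) ⟩
    2 ^ s * 2 ^ n * (2 ^ l ∸ 1) + 2 ^ s * (2 ^ n ∸ 1)
      ≡⟨ cong (λ v → v * (2 ^ l ∸ 1) + 2 ^ s * (2 ^ n ∸ 1)) (^-distribˡ-+-* 2 s n) ⟨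
    x + 2 ^ s * (2 ^ n ∸ 1)
      ∎
    where
    open ≡-Reasoning
    distrib : ∀ a b c e → a * (b * c + e) ≡ a * b * c + a * e
    distrib = solve-∀
  x<L : x < L
  x<L = ≤-<-trans (m≤m+n x _) (subst (_< L) a≡x+2^s*y a<L)
  c≡2^d : 2 ^ (l + n) ∸ 2 ^ n + (2 ^ n ∸ 1) + 1 ≡ 2 ^ d
  c≡2^d = begin
    2 ^ (l + n) ∸ 2 ^ n + (2 ^ n ∸ 1) + 1   ≡⟨ +-assoc (2 ^ (l + n) ∸ 2 ^ n) (2 ^ n ∸ 1) 1 ⟩
    2 ^ (l + n) ∸ 2 ^ n + (2 ^ n ∸ 1 + 1)   ≡⟨ cong (2 ^ (l + n) ∸ 2 ^ n +_) (2^n∸1+1≡2^n n) ⟩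
    2 ^ (l + n) ∸ 2 ^ n + 2 ^ n             ≡⟨ m∸n+n≡m (^-monoʳ-≤ 2 (m≤n+m n l)) ⟩
    2 ^ (l + n)                             ≡⟨ cong (2 ^_) l+n≡d ⟩
    2 ^ d                                   ∎
    where open ≡-Reasoning

scaledModRow-gap : ∀ {L} → Hyp L → ∀ j {s d} → 2 ^ j ∣ s → d ≤ 2 * 2 ^ j → 2 ^ s * (2 ^ d ∸ 1) < L →
                   ScaledModRow (2 ^ s * (2 ^ d ∸ 1) + 1) s d
scaledModRow-gap hyp j {d = d} 2^j∣s d≤2n a<L with ≤-total d (2 ^ j)
... | inj₁ d≤n = scaledModRow-short hyp j 2^j∣s d≤n a<L
... | inj₂ n≤d = scaledModRow-long hyp j 2^j∣s n≤d d≤2n a<L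

halve-2^k∣2*s : ∀ k {s} → 2 ^ k ∣ 2 * s → ∃ λ j → 2 ^ j ∣ s × 2 ^ k ≤ 2 * 2 ^ j
halve-2^k∣2*s zero          _          = 0 , 1∣ _ , s≤s z≤n
halve-2^k∣2*s (suc j) {s} 2^[1+j]∣2s = j , *-cancelˡ-∣ {2 ^ j} {s} 2 2^[1+j]∣2s , ≤-refl

lemma4p3 : (L : ℕ) → Hyp L →
    ∀ s s' → s ≤ s' → 2 ^ s' ∸ 2 ^ s < L →
    Σ ℕ (λ k → (2 ^ k ∣ 2 * s) × (s' ∸ s ≤ 2 ^ k)) →
    PeriodLength (2 ^ s' ∸ 2 ^ s + 1) (2 ^ (s' ∸ s))
lemma4p3 L hyp s s' s≤s' a<L (k , 2^k∣2s , d≤2^k) with halve-2^k∣2*s k {s} 2^k∣2s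
... | j , 2^j∣s , 2^k≤2*2^j =
  subst (λ a → PeriodLength (a + 1) (2 ^ (s' ∸ s))) (sym gap)
    (scaledModRow⇒periodLength s (s' ∸ s)
      (scaledModRow-gap hyp j {s} 2^j∣s (≤-trans d≤2^k 2^k≤2*2^j) (subst (_< L) gap a<L)))
  where
  gap : 2 ^ s' ∸ 2 ^ s ≡ 2 ^ s * (2 ^ (s' ∸ s) ∸ 1)
  gap = 2^s'∸2^s≡2^s*[2^[s'∸s]∸1] s≤s'
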